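{- Let $s\geq 1$ be an integer. Then $6s\leq N_2(K(3;3s))\leq 8s-1$, $12s\leq N_2(K(4;4s))\leq 15s-1$, and $20s\leq N_2(K(5;5s))\leq 24s-1$.
   Context: For a connected graph $G=(V,E)$, $N_2(G)$ is the minimum $N$ such that there is a map $g:V\to\{0,1,*\}^N$ with the property that for all $x,y\in V$, the graph distance between $x$ and $y$ equals the number of positions $j$ in which the $j$-th entries of $g(x)$ and $g(y)$ are distinct and neither equals $*$. For $a,m\geq 1$, $K(a;m)$ denotes the complete $m$-partite graph in which each of the $m$ parts has exactly $a$ vertices. -}

module Defs where

open import Level using (Level; _⊔_) renaming (suc to lsuc)
open import Data.Nat using (ℕ; zero; suc; _≤_)
open import Data.Fin using (Fin)
open import Data.Product using (_×_; _,_; Σ; ∃; proj₁)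
open import Data.Vec using (Vec; []; _∷_)
open import Relation.Binary.PropositionalEquality using (_≡_; _≢_)

record Graph : Set₁ where
  field
    V   : Set
    Adj : V → V → Set
open Graph public

data Walk (G : Graph) : V G → V G → ℕ → Set where
  nil  : ∀ {x} → Walk G x x zero
  cons : ∀ {x y z n} → Adj G x y → Walk G y z n → Walk G x z (suc n)

IsDist : (G : Graph) → V G → V G → ℕ → Set
IsDist G x y d = Walk G x y d × (∀ k → Walk G x y k → d ≤ k)

Connected : Graph → Set
Connected G = ∀ x y → ∃ λ d → Walk G x y d

data Sym : Set where
  s0 s1 star : Sym

symDist : Sym → Sym → ℕ
symDist s0 s1 = 1
symDist s1 s0 = 1
symDist _  _  = 0

wordDist : ∀ {N} → Vec Sym N → Vec Sym N → ℕ
wordDist []       []       = 0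
wordDist (a ∷ u)  (b ∷ v)  = symDist a b Data.Nat.+ wordDist u v

IsAddressing : (G : Graph) (N : ℕ) → (V G → Vec Sym N) → Set
IsAddressing G N g = ∀ x y → IsDist G x y (wordDist (g x) (g y))

N₂≥ : Graph → ℕ → Set
N₂≥ G k = ∀ N (g : V G → Vec Sym N) → IsAddressing G N g → k ≤ N

N₂≤ : Graph → ℕ → Set
N₂≤ G k = Σ ℕ λ N → N ≤ k × Σ (V G → Vec Sym N) (IsAddressing G N)

-- K(a;m): complete m-partite graph, parts of size a; vertex (i , t) lies in part i.
K : ℕ → ℕ → Graph
K a m = record { V = Fin m × Fin a ; Adj = λ x y → proj₁ x ≢ proj₁ y }

-- The lower bound is an eigenvalue argument of Graham–Pollak type. The distance matrix of K(a+1;m) is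
-- J + P - 2I, with P the same-part matrix, so its quadratic form is -2|x|² on the vectors x summing to
-- zero on every part. An addressing of length N writes the distance matrix as the sum over positions j
-- of z_j o_jᵀ + o_j z_jᵀ, where z_j and o_j mark the vertices whose word has 0 resp. 1 at j, so the form
-- vanishes as soon as every z_j·x = 0. These m + N homogeneous conditions have a nonzero integer
-- solution when m + N < m(a+1); hence N ≥ ma.
-- The upper bound places s copies of an explicit addressing of K(a;a), checked by computation, in
-- separate blocks of positions, and separates distinct copies by a unary code of length s - 1.

module Submission where

open import Defs

open import Data.Nat as ℕ using (ℕ; zero; suc; _≤_; _<_; _∸_; z≤n; s≤s)
open import Data.Nat.Properties as ℕ using (≤-antisym; ≤-trans; ≤-reflexive; m≤m*n)
open import Data.Fin using (Fin; zero; suc; _≟_; combine; remQuot)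
open import Data.Fin.Properties using (combine-remQuot; combine-injectiveˡ; combine-injectiveʳ; all?)
open import Data.Product using (_×_; _,_; proj₁; proj₂; uncurry)
open import Data.Vec using (Vec; []; _∷_; _++_; replicate; lookup)
open import Data.Empty using (⊥-elim)
open import Function using (_∘_)
open import Function.Definitions using (Injective)
open import Relation.Nullary using (Dec; yes; no)
open import Relation.Nullary.Decidable using (True; toWitness)
open import Relation.Binary.PropositionalEquality

module _ {m a : ℕ} where

  kDist : Fin m × Fin a → Fin m × Fin a → ℕ
  kDist (i , t) (j , u) with i ≟ j | t ≟ u
  ... | yes _ | yes _ = 0
  ... | yes _ | no _  = 2
  ... | no _  | _     = 1

  kDist-across : ∀ {i j} t u → i ≢ j → kDist (i , t) (j , u) ≡ 1
  kDist-across {i} {j} t u i≢j with i ≟ j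
  ... | yes i≡j = ⊥-elim (i≢j i≡j)
  ... | no _    = refl

  kDist-self : ∀ v → kDist v v ≡ 0
  kDist-self (i , t) with i ≟ i | t ≟ t
  ... | yes _ | yes _   = refl
  ... | yes _ | no t≢t  = ⊥-elim (t≢t refl)
  ... | no i≢i | _      = ⊥-elim (i≢i refl)

  kDist-inside : ∀ i {t u} → t ≢ u → kDist (i , t) (i , u) ≡ 2
  kDist-inside i {t} {u} t≢u with i ≟ i | t ≟ u
  ... | yes _  | yes t≡u = ⊥-elim (t≢u t≡u)
  ... | yes _  | no _    = refl
  ... | no i≢i | _       = ⊥-elim (i≢i refl)

kDist-relabel : ∀ {m m′ a} {f : Fin m → Fin m′} → Injective _≡_ _≡_ f →
                ∀ i j (t u : Fin a) → kDist (f i , t) (f j , u) ≡ kDist (i , t) (j , u)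
kDist-relabel {f = f} f-inj i j t u with f i ≟ f j | i ≟ j | t ≟ u
... | yes _     | yes _   | yes _ = refl
... | yes _     | yes _   | no _  = refl
... | yes fi≡fj | no i≢j  | _     = ⊥-elim (i≢j (f-inj fi≡fj))
... | no fi≢fj  | yes i≡j | _     = ⊥-elim (fi≢fj (cong f i≡j))
... | no _      | no _    | _     = refl

walk-zero : ∀ {G x y} → Walk G x y 0 → x ≡ y
walk-zero nil = refl

walk-one : ∀ {a m x y} → Walk (K a m) x y 1 → proj₁ x ≢ proj₁ y
walk-one (cons x≁y nil) = x≁y

another : ∀ {m} → Fin (suc (suc m)) → Fin (suc (suc m))
another zero    = suc zero
another (suc _) = zero

another-≢ : ∀ {m} (i : Fin (suc (suc m))) → i ≢ another i
another-≢ zero    ()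
another-≢ (suc _) ()

kDist-isDist : ∀ {m a} → 2 ≤ m → ∀ v w → IsDist (K a m) v w (kDist v w)
kDist-isDist {suc (suc m)} {a} (s≤s (s≤s z≤n)) (i , t) (j , u) with i ≟ j | t ≟ u
... | yes refl | yes refl = nil , λ _ _ → z≤n
... | yes refl | no t≢u   =
  cons {y = another i , t} (another-≢ i) (cons (another-≢ i ∘ sym) nil) , shortest
  where
  shortest : ∀ k → Walk (K a (suc (suc m))) (i , t) (i , u) k → 2 ≤ k
  shortest zero          w = ⊥-elim (t≢u (cong proj₂ (walk-zero w)))
  shortest (suc zero)    w = ⊥-elim (walk-one w refl)
  shortest (suc (suc _)) w = s≤s (s≤s z≤n)
... | no i≢j   | _        = cons i≢j nil , shortest
  where
  shortest : ∀ k → Walk (K a (suc (suc m))) (i , t) (j , u) k → 1 ≤ k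
  shortest zero    w = ⊥-elim (i≢j (cong proj₁ (walk-zero w)))
  shortest (suc _) w = s≤s z≤n

isDist-unique : ∀ {G x y d e} → IsDist G x y d → IsDist G x y e → d ≡ e
isDist-unique (w , d-min) (w′ , e-min) = ≤-antisym (d-min _ w′) (e-min _ w)

module _ {a m N : ℕ} (2≤m : 2 ≤ m) (g : Fin m × Fin a → Vec Sym N) where

  isAddressing⇒kDist : IsAddressing (K a m) N g → ∀ v w → wordDist (g v) (g w) ≡ kDist v w
  isAddressing⇒kDist g-addr v w = isDist-unique (g-addr v w) (kDist-isDist 2≤m v w)

  kDist⇒isAddressing : (∀ v w → wordDist (g v) (g w) ≡ kDist v w) → IsAddressing (K a m) N g
  kDist⇒isAddressing g-kDist v w = subst (IsDist _ v w) (sym (g-kDist v w)) (kDist-isDist 2≤m v w)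

N₂≥-mono : ∀ {G k l} → l ≤ k → N₂≥ G k → N₂≥ G l
N₂≥-mono l≤k G≥k N g g-addr = ≤-trans l≤k (G≥k N g g-addr)

N₂≤-mono : ∀ {G k l} → k ≤ l → N₂≤ G k → N₂≤ G l
N₂≤-mono k≤l (N , N≤k , g) = N , ≤-trans N≤k k≤l , g

module LowerBound where

  open import Data.Integer using (ℤ; +_; 0ℤ; 1ℤ; _+_; _*_; -_; _-_)
  import Data.Integer as ℤ
  import Data.Integer.Properties as ℤ
  open import Data.Integer.Tactic.RingSolver using (solve-∀)
  open import Data.Vec.Functional using (Vector)
  open import Data.Vec using (head; tail)
  open import Algebra.Properties.Semiring.Sum ℤ.+-*-semiring
    using (sum; ∑-distrib-+; ∑-comm; *-distribˡ-sum; *-distribʳ-sum; sum-cong-≗; sum-replicate-zero)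
  open import Data.List as List using (List; []; _∷_; length; map; tabulate)
  open import Data.List.Properties using (length-map; length-tabulate; length-++; length-removeAt′)
  open import Data.List.Relation.Unary.All as All using (All; []; _∷_)
  open import Data.List.Relation.Unary.All.Properties using (map⁻; ++⁻; tabulate⁻; ─⁻; ¬All⇒Any¬)
  open import Data.List.Relation.Unary.Any as Any using (Any; _─_)
  open import Data.List.Relation.Unary.Any.Properties using (lookup-result)
  open import Data.Product using (∃)
  open import Data.Sum using (inj₂; [_,_]′; reduce)
  open import Data.Empty using (⊥)

  dot : ∀ {n} → Vector ℤ n → Vector ℤ n → ℤ
  dot u x = sum (λ k → u k * x k)

  sum-zero : ∀ {n} {f : Vector ℤ n} → (∀ k → f k ≡ 0ℤ) → sum f ≡ 0ℤ
  sum-zero {n} f≡0 = trans (sum-cong-≗ f≡0) (sum-replicate-zero n)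

  dot-+ˡ : ∀ {n} (u v x : Vector ℤ n) → dot (λ l → u l + v l) x ≡ dot u x + dot v x
  dot-+ˡ u v x = trans (sum-cong-≗ (λ l → ℤ.*-distribʳ-+ (x l) (u l) (v l))) (∑-distrib-+ (λ l → u l * x l) (λ l → v l * x l))

  dot-*ˡ : ∀ {n} c (u x : Vector ℤ n) → dot (λ l → c * u l) x ≡ c * dot u x
  dot-*ˡ c u x = trans (sum-cong-≗ (λ l → ℤ.*-assoc c (u l) (x l))) (sym (*-distribˡ-sum c (λ l → u l * x l)))

  dot-*ʳ : ∀ {n} c (u x : Vector ℤ n) → dot u (λ k → c * x k) ≡ c * dot u x
  dot-*ʳ c u x = trans (sum-cong-≗ (λ k → swap (u k) c (x k))) (sym (*-distribˡ-sum c (λ k → u k * x k)))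
    where
    swap : ∀ a b c → a * (b * c) ≡ b * (a * c)
    swap = solve-∀

  Solves : ∀ {n} → List (Vector ℤ n) → Vector ℤ n → Set
  Solves E x = All (λ e → dot e x ≡ 0ℤ) E

  NonTrivial : ∀ {n} → Vector ℤ n → Set
  NonTrivial x = ∃ λ k → x k ≢ 0ℤ

  unit₀ : ∀ {n} → Vector ℤ (suc n)
  unit₀ zero    = 1ℤ
  unit₀ (suc _) = 0ℤ

  dot-unit₀ : ∀ {n} (e : Vector ℤ (suc n)) → e zero ≡ 0ℤ → dot e unit₀ ≡ 0ℤ
  dot-unit₀ e e₀≡0 =
    cong₂ _+_ (trans (ℤ.*-identityʳ (e zero)) e₀≡0) (sum-zero (λ k → ℤ.*-zeroʳ (e (suc k))))

  eliminate : ∀ {n} → Vector ℤ (suc n) → Vector ℤ (suc n) → Vector ℤ n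
  eliminate e b k = e zero * b (suc k) - b zero * e (suc k)

  extend : ∀ {n} → Vector ℤ (suc n) → Vector ℤ n → Vector ℤ (suc n)
  extend e y zero    = - dot (e ∘ suc) y
  extend e y (suc k) = e zero * y k

  dot-extend : ∀ {n} (e b : Vector ℤ (suc n)) y → dot b (extend e y) ≡ dot (eliminate e b) y
  dot-extend e b y = begin
    b zero * - E′ + sum (λ k → b (suc k) * (a * y k))
      ≡⟨ cong (λ z → b zero * - E′ + z) (dot-*ʳ a (b ∘ suc) y) ⟩
    b zero * - E′ + a * B′
      ≡⟨ regroup (b zero) E′ a B′ ⟩
    a * B′ + - b zero * E′
      ≡⟨ cong₂ _+_ (*-distribˡ-sum a (λ k → b (suc k) * y k)) (*-distribˡ-sum (- b zero) (λ k → e (suc k) * y k)) ⟩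
    sum (λ k → a * (b (suc k) * y k)) + sum (λ k → - b zero * (e (suc k) * y k))
      ≡⟨ ∑-distrib-+ (λ k → a * (b (suc k) * y k)) (λ k → - b zero * (e (suc k) * y k)) ⟨
    sum (λ k → a * (b (suc k) * y k) + - b zero * (e (suc k) * y k))
      ≡⟨ sum-cong-≗ (λ k → collect a (b (suc k)) (b zero) (e (suc k)) (y k)) ⟩
    dot (eliminate e b) y ∎
    where
    open ≡-Reasoning
    a E′ B′ : ℤ
    a = e zero
    E′ = dot (e ∘ suc) y
    B′ = dot (b ∘ suc) y
    regroup : ∀ b₀ E a B → b₀ * - E + a * B ≡ a * B + - b₀ * E
    regroup = solve-∀
    collect : ∀ a b b₀ e y → a * (b * y) + - b₀ * (e * y) ≡ (a * b - b₀ * e) * y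
    collect = solve-∀

  dot-eliminate-self : ∀ {n} (e : Vector ℤ (suc n)) y → dot (eliminate e e) y ≡ 0ℤ
  dot-eliminate-self e y =
    sum-zero (λ k → trans (cong (_* y k) (ℤ.+-inverseʳ (e zero * e (suc k)))) (ℤ.*-zeroˡ (y k)))

  pivot-step : ∀ {n} (E : List (Vector ℤ (suc n))) (p : Any (λ e → e zero ≢ 0ℤ) E) {y} →
               NonTrivial y → Solves (map (eliminate (Any.lookup p)) (E ─ p)) y →
               NonTrivial (extend (Any.lookup p) y) × Solves E (extend (Any.lookup p) y)
  pivot-step E p {y} (k , yₖ≢0) y-solves = (suc k , nonzero) , ─⁻ p pivot-solved rest-solved
    where
    pivot : Vector ℤ (suc _)
    pivot = Any.lookup p
    nonzero : pivot zero * y k ≢ 0ℤ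
    nonzero = [ lookup-result p , yₖ≢0 ]′ ∘ ℤ.i*j≡0⇒i≡0∨j≡0 (pivot zero)
    pivot-solved : dot pivot (extend pivot y) ≡ 0ℤ
    pivot-solved = trans (dot-extend pivot pivot y) (dot-eliminate-self pivot y)
    rest-solved : Solves (E ─ p) (extend pivot y)
    rest-solved = All.map (λ {b} eq → trans (dot-extend pivot b y) eq) (map⁻ y-solves)

  eliminated-shorter : ∀ {n} (E : List (Vector ℤ (suc n))) (p : Any (λ e → e zero ≢ 0ℤ) E) →
                       length E < suc n → length (map (eliminate (Any.lookup p)) (E ─ p)) < n
  eliminated-shorter {n} E p len< =
    subst (_< n) (sym (length-map _ (E ─ p))) (ℕ.≤-pred (subst (_< suc n) (length-removeAt′ E (Any.index p)) len<))

  nontrivial-solution : ∀ {n} (E : List (Vector ℤ n)) → length E < n → ∃ λ x → NonTrivial x × Solves E x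
  nontrivial-solution {suc n} E len< with All.all? (λ e → e zero ℤ.≟ 0ℤ) E
  ... | yes vanish = unit₀ , (zero , λ ()) , All.map (λ {e} → dot-unit₀ e) vanish
  ... | no ¬vanish with ¬All⇒Any¬ (λ e → e zero ℤ.≟ 0ℤ) E ¬vanish
  ...   | p with nontrivial-solution (map (eliminate (Any.lookup p)) (E ─ p)) (eliminated-shorter E p len<)
  ...     | y , y≢0 , y-solves = extend (Any.lookup p) y , pivot-step E p y≢0 y-solves

  quadratic : ∀ {n} → (Fin n → Fin n → ℤ) → Vector ℤ n → ℤ
  quadratic d x = sum (λ k → x k * dot (d k) x)

  quadratic-cong : ∀ {n} {d d′ : Fin n → Fin n → ℤ} → (∀ k l → d k l ≡ d′ k l) → ∀ x → quadratic d x ≡ quadratic d′ x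
  quadratic-cong d≡d′ x = sum-cong-≗ (λ k → cong (x k *_) (sum-cong-≗ (λ l → cong (_* x l) (d≡d′ k l))))

  quadratic-+ : ∀ {n} (d d′ : Fin n → Fin n → ℤ) x →
                quadratic (λ k l → d k l + d′ k l) x ≡ quadratic d x + quadratic d′ x
  quadratic-+ d d′ x =
    trans (sum-cong-≗ (λ k → trans (cong (x k *_) (dot-+ˡ (d k) (d′ k) x)) (ℤ.*-distribˡ-+ (x k) _ _)))
          (∑-distrib-+ (λ k → x k * dot (d k) x) (λ k → x k * dot (d′ k) x))

  quadratic-outer : ∀ {n} (u v x : Vector ℤ n) → quadratic (λ k l → u k * v l) x ≡ dot u x * dot v x
  quadratic-outer u v x =
    trans (sum-cong-≗ (λ k → trans (cong (x k *_) (dot-*ˡ (u k) v x)) (swap (x k) (u k) (dot v x))))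
          (sym (*-distribʳ-sum (dot v x) (λ k → u k * x k)))
    where
    swap : ∀ a b c → a * (b * c) ≡ b * a * c
    swap = solve-∀

  zeroIndicator oneIndicator : Sym → ℤ
  zeroIndicator s0 = 1ℤ
  zeroIndicator _  = 0ℤ
  oneIndicator s1 = 1ℤ
  oneIndicator _  = 0ℤ

  symDist-indicators : ∀ s t → + symDist s t ≡ zeroIndicator s * oneIndicator t + oneIndicator s * zeroIndicator t
  symDist-indicators s0   s0   = refl
  symDist-indicators s0   s1   = refl
  symDist-indicators s0   star = refl
  symDist-indicators s1   s0   = refl
  symDist-indicators s1   s1   = refl
  symDist-indicators s1   star = refl
  symDist-indicators star s0   = refl
  symDist-indicators star s1   = refl
  symDist-indicators star star = refl

  wordDist-[] : (u v : Vec Sym 0) → wordDist u v ≡ 0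
  wordDist-[] [] [] = refl

  wordDist-∷ : ∀ {N} (u v : Vec Sym (suc N)) → wordDist u v ≡ symDist (head u) (head v) ℕ.+ wordDist (tail u) (tail v)
  wordDist-∷ (_ ∷ _) (_ ∷ _) = refl

  zeroForms : ∀ {n N} → (Fin n → Vec Sym N) → List (Vector ℤ n)
  zeroForms {N = zero}  w = []
  zeroForms {N = suc N} w = (λ k → zeroIndicator (head (w k))) ∷ zeroForms (tail ∘ w)

  length-zeroForms : ∀ {n N} (w : Fin n → Vec Sym N) → length (zeroForms w) ≡ N
  length-zeroForms {N = zero}  w = refl
  length-zeroForms {N = suc N} w = cong suc (length-zeroForms (tail ∘ w))

  quadratic-wordDist : ∀ {n N} (w : Fin n → Vec Sym N) {x} → Solves (zeroForms w) x →
                       quadratic (λ k l → + wordDist (w k) (w l)) x ≡ 0ℤ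
  quadratic-wordDist {N = zero} w {x} _ =
    trans (quadratic-cong (λ k l → cong +_ (wordDist-[] (w k) (w l))) x)
          (sum-zero (λ k → trans (cong (x k *_) (sum-zero {f = λ l → 0ℤ * x l} (λ l → refl))) (ℤ.*-zeroʳ (x k))))
  quadratic-wordDist {N = suc N} w {x} (z·x≡0 ∷ tails-solved) = begin
    quadratic (λ k l → + wordDist (w k) (w l)) x
      ≡⟨ quadratic-cong split x ⟩
    quadratic (λ k l → z k * o l + o k * z l + tails k l) x
      ≡⟨ quadratic-+ (λ k l → z k * o l + o k * z l) tails x ⟩
    quadratic (λ k l → z k * o l + o k * z l) x + quadratic tails x
      ≡⟨ cong₂ _+_ (quadratic-+ (λ k l → z k * o l) (λ k l → o k * z l) x) (quadratic-wordDist (tail ∘ w) tails-solved) ⟩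
    quadratic (λ k l → z k * o l) x + quadratic (λ k l → o k * z l) x + 0ℤ
      ≡⟨ cong (λ q → q + 0ℤ) (cong₂ _+_ (quadratic-outer z o x) (quadratic-outer o z x)) ⟩
    dot z x * dot o x + dot o x * dot z x + 0ℤ
      ≡⟨ cong (λ ζ → ζ * dot o x + dot o x * ζ + 0ℤ) z·x≡0 ⟩
    0ℤ * dot o x + dot o x * 0ℤ + 0ℤ
      ≡⟨ vanish (dot o x) ⟩
    0ℤ ∎
    where
    open ≡-Reasoning
    z o : Vector ℤ _
    z k = zeroIndicator (head (w k))
    o k = oneIndicator (head (w k))
    tails : Fin _ → Fin _ → ℤ
    tails k l = + wordDist (tail (w k)) (tail (w l))
    split : ∀ k l → + wordDist (w k) (w l) ≡ z k * o l + o k * z l + tails k l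
    split k l = trans (cong +_ (wordDist-∷ (w k) (w l)))
                      (trans (ℤ.pos-+ (symDist (head (w k)) (head (w l))) _)
                             (cong (λ d → d + tails k l) (symDist-indicators (head (w k)) (head (w l)))))
    vanish : ∀ a → 0ℤ * a + a * 0ℤ + 0ℤ ≡ 0ℤ
    vanish = solve-∀

  δ : ∀ {n} → Fin n → Fin n → ℤ
  δ zero    zero    = 1ℤ
  δ zero    (suc _) = 0ℤ
  δ (suc _) zero    = 0ℤ
  δ (suc i) (suc j) = δ i j

  δ-refl : ∀ {n} (i : Fin n) → δ i i ≡ 1ℤ
  δ-refl zero    = refl
  δ-refl (suc i) = δ-refl i

  δ-≢ : ∀ {n} {i j : Fin n} → i ≢ j → δ i j ≡ 0ℤ
  δ-≢ {i = zero}  {zero}  i≢j = ⊥-elim (i≢j refl)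
  δ-≢ {i = zero}  {suc _} i≢j = refl
  δ-≢ {i = suc _} {zero}  i≢j = refl
  δ-≢ {i = suc i} {suc j} i≢j = δ-≢ (i≢j ∘ cong suc)

  δ-sym : ∀ {n} (i j : Fin n) → δ i j ≡ δ j i
  δ-sym zero    zero    = refl
  δ-sym zero    (suc _) = refl
  δ-sym (suc _) zero    = refl
  δ-sym (suc i) (suc j) = δ-sym i j

  dot-δ : ∀ {n} (i : Fin n) (x : Vector ℤ n) → dot (δ i) x ≡ x i
  dot-δ zero    x = trans (cong₂ _+_ (ℤ.*-identityˡ (x zero)) (sum-zero (λ k → ℤ.*-zeroˡ (x (suc k)))))
                          (ℤ.+-identityʳ (x zero))
  dot-δ (suc i) x = trans (ℤ.+-identityˡ _) (dot-δ i (x ∘ suc))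

  partForm : ∀ {n m} → (Fin n → Fin m) → Fin m → Vector ℤ n
  partForm p i l = δ i (p l)

  sum-by-parts : ∀ {n m} (p : Fin n → Fin m) (x : Vector ℤ n) → sum x ≡ sum (λ i → dot (partForm p i) x)
  sum-by-parts p x =
    trans (sum-cong-≗ (λ l → trans (sym (dot-δ (p l) (λ _ → x l))) (sum-cong-≗ (λ i → cong (_* x l) (δ-sym (p l) i)))))
          (∑-comm (λ l i → δ i (p l) * x l))

  kDist-distinct : ∀ {m a} {v w : Fin m × Fin a} → v ≢ w → + kDist v w ≡ 1ℤ + δ (proj₁ v) (proj₁ w)
  kDist-distinct {v = i , t} {j , u} v≢w = by-cases (i ≟ j)
    where
    by-cases : Dec (i ≡ j) → + kDist (i , t) (j , u) ≡ 1ℤ + δ i j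
    by-cases (yes refl) rewrite kDist-inside i (v≢w ∘ cong (i ,_)) | δ-refl i = refl
    by-cases (no i≢j)   rewrite kDist-across t u i≢j | δ-≢ i≢j = refl

  kDist-kronecker : ∀ {n m a} (f : Fin n → Fin m × Fin a) → Injective _≡_ _≡_ f → ∀ k l →
                    + kDist (f k) (f l) ≡ 1ℤ + δ (proj₁ (f k)) (proj₁ (f l)) - + 2 * δ k l
  kDist-kronecker f f-inj k l with k ≟ l
  ... | yes refl rewrite kDist-self (f k) | δ-refl (proj₁ (f k)) | δ-refl k = refl
  ... | no k≢l   rewrite δ-≢ k≢l = trans (kDist-distinct (k≢l ∘ f-inj)) (sym (ℤ.+-identityʳ _))

  quadratic-kDist : ∀ {n m a} (f : Fin n → Fin m × Fin a) → Injective _≡_ _≡_ f → ∀ {x} →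
                    (∀ i → dot (partForm (proj₁ ∘ f) i) x ≡ 0ℤ) →
                    quadratic (λ k l → + kDist (f k) (f l)) x ≡ - + 2 * sum (λ k → x k * x k)
  quadratic-kDist f f-inj {x} parts-vanish = begin
    quadratic (λ k l → + kDist (f k) (f l)) x
      ≡⟨ quadratic-cong (kDist-kronecker f f-inj) x ⟩
    sum (λ k → x k * dot (λ l → 1ℤ + δ (p k) (p l) - + 2 * δ k l) x)
      ≡⟨ sum-cong-≗ (λ k → cong (x k *_) (row k)) ⟩
    sum (λ k → x k * (- + 2 * x k))
      ≡⟨ sum-cong-≗ (λ k → swap (x k) (- + 2) (x k)) ⟩
    sum (λ k → - + 2 * (x k * x k))
      ≡⟨ *-distribˡ-sum (- + 2) (λ k → x k * x k) ⟨
    - + 2 * sum (λ k → x k * x k) ∎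
    where
    open ≡-Reasoning
    p : Fin _ → Fin _
    p = proj₁ ∘ f
    sum≡0 : sum x ≡ 0ℤ
    sum≡0 = trans (sum-by-parts p x) (sum-zero parts-vanish)
    swap : ∀ a b c → a * (b * c) ≡ b * (a * c)
    swap = solve-∀
    row : ∀ k → dot (λ l → 1ℤ + δ (p k) (p l) - + 2 * δ k l) x ≡ - + 2 * x k
    row k = begin
      dot (λ l → 1ℤ + δ (p k) (p l) - + 2 * δ k l) x
        ≡⟨ dot-+ˡ (λ l → 1ℤ + δ (p k) (p l)) (λ l → - (+ 2 * δ k l)) x ⟩
      dot (λ l → 1ℤ + δ (p k) (p l)) x + dot (λ l → - (+ 2 * δ k l)) x
        ≡⟨ cong₂ _+_ (dot-+ˡ (λ _ → 1ℤ) (partForm p (p k)) x)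
                     (trans (sum-cong-≗ (λ l → cong (_* x l) (ℤ.neg-distribˡ-* (+ 2) (δ k l))))
                            (dot-*ˡ (- + 2) (δ k) x)) ⟩
      dot (λ _ → 1ℤ) x + dot (partForm p (p k)) x + - + 2 * dot (δ k) x
        ≡⟨ cong₂ (λ s d → s + d + - + 2 * dot (δ k) x)
                 (trans (sum-cong-≗ (λ l → ℤ.*-identityˡ (x l))) sum≡0) (parts-vanish (p k)) ⟩
      0ℤ + - + 2 * dot (δ k) x
        ≡⟨ trans (ℤ.+-identityˡ _) (cong (- + 2 *_) (dot-δ k x)) ⟩
      - + 2 * x k ∎

  +-nonneg≡0 : ∀ {i j} → 0ℤ ℤ.≤ i → 0ℤ ℤ.≤ j → i + j ≡ 0ℤ → i ≡ 0ℤ × j ≡ 0ℤ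
  +-nonneg≡0 {+ m} {+ n} _ _ m+n≡0 =
    cong +_ (ℕ.m+n≡0⇒m≡0 m (ℤ.+-injective m+n≡0)) , cong +_ (ℕ.m+n≡0⇒n≡0 m (ℤ.+-injective m+n≡0))

  sum-nonneg : ∀ {n} {f : Vector ℤ n} → (∀ k → 0ℤ ℤ.≤ f k) → 0ℤ ℤ.≤ sum f
  sum-nonneg {zero}  f≥0 = ℤ.≤-refl
  sum-nonneg {suc n} f≥0 = ℤ.+-mono-≤ (f≥0 zero) (sum-nonneg (f≥0 ∘ suc))

  sum-nonneg≡0 : ∀ {n} {f : Vector ℤ n} → (∀ k → 0ℤ ℤ.≤ f k) → sum f ≡ 0ℤ → ∀ k → f k ≡ 0ℤ
  sum-nonneg≡0 f≥0 sum≡0 zero    = proj₁ (+-nonneg≡0 (f≥0 zero) (sum-nonneg (f≥0 ∘ suc)) sum≡0)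
  sum-nonneg≡0 f≥0 sum≡0 (suc k) =
    sum-nonneg≡0 (f≥0 ∘ suc) (proj₂ (+-nonneg≡0 (f≥0 zero) (sum-nonneg (f≥0 ∘ suc)) sum≡0)) k

  square-nonneg : ∀ i → 0ℤ ℤ.≤ i * i
  square-nonneg (+ n)      = subst (0ℤ ℤ.≤_) (ℤ.pos-* n n) (ℤ.+≤+ z≤n)
  square-nonneg ℤ.-[1+ n ] = ℤ.+≤+ z≤n

  sum-squares≡0 : ∀ {n} (x : Vector ℤ n) → sum (λ k → x k * x k) ≡ 0ℤ → ∀ k → x k ≡ 0ℤ
  sum-squares≡0 x squares≡0 k =
    reduce (ℤ.i*j≡0⇒i≡0∨j≡0 (x k) (sum-nonneg≡0 (λ k → square-nonneg (x k)) squares≡0 k))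

  N₂≥-K : ∀ {a m} → 2 ≤ m → N₂≥ (K (suc a) m) (m ℕ.* a)
  N₂≥-K {a} {m} 2≤m N g g-addr = ℕ.≮⇒≥ (λ N<ma → no-solution (nontrivial-solution equations (fewer N<ma)))
    where
    vertex : Fin (m ℕ.* suc a) → Fin m × Fin (suc a)
    vertex = remQuot (suc a)

    vertex-injective : Injective _≡_ _≡_ vertex
    vertex-injective {k} {l} eq =
      trans (sym (combine-remQuot {m} (suc a) k)) (trans (cong (uncurry combine) eq) (combine-remQuot {m} (suc a) l))

    equations : List (Vector ℤ (m ℕ.* suc a))
    equations = tabulate (partForm (proj₁ ∘ vertex)) List.++ zeroForms (g ∘ vertex)

    fewer : N < m ℕ.* a → length equations < m ℕ.* suc a
    fewer N<ma = begin-strict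
      length equations
        ≡⟨ length-++ (tabulate (partForm (proj₁ ∘ vertex))) ⟩
      length (tabulate (partForm (proj₁ ∘ vertex))) ℕ.+ length (zeroForms (g ∘ vertex))
        ≡⟨ cong₂ ℕ._+_ (length-tabulate _) (length-zeroForms (g ∘ vertex)) ⟩
      m ℕ.+ N
        <⟨ ℕ.+-monoʳ-< m N<ma ⟩
      m ℕ.+ m ℕ.* a
        ≡⟨ ℕ.*-suc m a ⟨
      m ℕ.* suc a ∎
      where open ℕ.≤-Reasoning

    no-solution : (∃ λ x → NonTrivial x × Solves equations x) → ⊥
    no-solution (x , (k , xₖ≢0) , solves) = xₖ≢0 (sum-squares≡0 x squares≡0 k)
      where
      parts-vanish : ∀ i → dot (partForm (proj₁ ∘ vertex) i) x ≡ 0ℤ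
      parts-vanish = tabulate⁻ (proj₁ (++⁻ (tabulate (partForm (proj₁ ∘ vertex))) solves))
      zeros-vanish : Solves (zeroForms (g ∘ vertex)) x
      zeros-vanish = proj₂ (++⁻ (tabulate (partForm (proj₁ ∘ vertex))) solves)
      form≡0 : - + 2 * sum (λ k → x k * x k) ≡ 0ℤ
      form≡0 = begin
        - + 2 * sum (λ k → x k * x k)
          ≡⟨ quadratic-kDist vertex vertex-injective parts-vanish ⟨
        quadratic (λ k l → + kDist (vertex k) (vertex l)) x
          ≡⟨ quadratic-cong (λ k l → cong +_ (isAddressing⇒kDist 2≤m g g-addr (vertex k) (vertex l))) x ⟨
        quadratic (λ k l → + wordDist (g (vertex k)) (g (vertex l))) x
          ≡⟨ quadratic-wordDist (g ∘ vertex) zeros-vanish ⟩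
        0ℤ ∎
        where open ≡-Reasoning
      squares≡0 : sum (λ k → x k * x k) ≡ 0ℤ
      squares≡0 with ℤ.i*j≡0⇒i≡0∨j≡0 (- + 2) form≡0
      ... | inj₂ squares≡0 = squares≡0

open LowerBound using (N₂≥-K)

open import Data.Nat using (_+_; _*_)

wordDist-++ : ∀ {k l} (u u′ : Vec Sym k) (v v′ : Vec Sym l) →
              wordDist (u ++ v) (u′ ++ v′) ≡ wordDist u u′ + wordDist v v′
wordDist-++ []      []       v v′ = refl
wordDist-++ (x ∷ u) (x′ ∷ u′) v v′ =
  trans (cong (symDist x x′ +_) (wordDist-++ u u′ v v′)) (sym (ℕ.+-assoc (symDist x x′) _ _))

wordDist-starsˡ : ∀ {n} (v : Vec Sym n) → wordDist (replicate n star) v ≡ 0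
wordDist-starsˡ []      = refl
wordDist-starsˡ (_ ∷ v) = wordDist-starsˡ v

wordDist-starsʳ : ∀ {n} (v : Vec Sym n) → wordDist v (replicate n star) ≡ 0
wordDist-starsʳ []         = refl
wordDist-starsʳ (s0 ∷ v)   = wordDist-starsʳ v
wordDist-starsʳ (s1 ∷ v)   = wordDist-starsʳ v
wordDist-starsʳ (star ∷ v) = wordDist-starsʳ v

wordDist-self : ∀ {n} (v : Vec Sym n) → wordDist v v ≡ 0
wordDist-self []         = refl
wordDist-self (s0 ∷ v)   = wordDist-self v
wordDist-self (s1 ∷ v)   = wordDist-self v
wordDist-self (star ∷ v) = wordDist-self v

module _ {L : ℕ} where

  inBlock : ∀ {s} → Fin s → Vec Sym L → Vec Sym (s * L)
  inBlock {suc s} zero    w = w ++ replicate (s * L) star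
  inBlock {suc s} (suc c) w = replicate L star ++ inBlock c w

  inBlock-same : ∀ {s} (c : Fin s) w w′ → wordDist (inBlock c w) (inBlock c w′) ≡ wordDist w w′
  inBlock-same {suc s} zero w w′ = begin
    wordDist (w ++ stars) (w′ ++ stars)  ≡⟨ wordDist-++ w w′ stars stars ⟩
    wordDist w w′ + wordDist stars stars ≡⟨ cong (wordDist w w′ +_) (wordDist-self stars) ⟩
    wordDist w w′ + 0                  ≡⟨ ℕ.+-identityʳ _ ⟩
    wordDist w w′                        ∎
    where open ≡-Reasoning
          stars = replicate (s * L) star
  inBlock-same {suc s} (suc c) w w′ =
    trans (wordDist-++ (replicate L star) _ (inBlock c w) _)
          (cong₂ _+_ (wordDist-self (replicate L star)) (inBlock-same c w w′))

  inBlock-apart : ∀ {s} {c d : Fin s} w w′ → c ≢ d → wordDist (inBlock c w) (inBlock d w′) ≡ 0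
  inBlock-apart {suc s} {zero}  {zero}  w w′ c≢d = ⊥-elim (c≢d refl)
  inBlock-apart {suc s} {zero}  {suc d} w w′ c≢d =
    trans (wordDist-++ w _ _ (inBlock d w′)) (cong₂ _+_ (wordDist-starsʳ w) (wordDist-starsˡ (inBlock d w′)))
  inBlock-apart {suc s} {suc c} {zero}  w w′ c≢d =
    trans (wordDist-++ (replicate L star) w′ (inBlock c w) _) (cong₂ _+_ (wordDist-starsˡ w′) (wordDist-starsʳ (inBlock c w)))
  inBlock-apart {suc s} {suc c} {suc d} w w′ c≢d =
    trans (wordDist-++ (replicate L star) _ (inBlock c w) _)
          (cong₂ _+_ (wordDist-self (replicate L star)) (inBlock-apart w w′ (c≢d ∘ cong suc)))

unaryCode : ∀ {s} → Fin (suc s) → Vec Sym s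
unaryCode {zero}  zero    = []
unaryCode {suc s} zero    = s0 ∷ replicate s star
unaryCode {suc s} (suc c) = s1 ∷ unaryCode c

unaryCode-apart : ∀ {s} {c d : Fin (suc s)} → c ≢ d → wordDist (unaryCode c) (unaryCode d) ≡ 1
unaryCode-apart {zero}  {zero}  {zero}  c≢d = ⊥-elim (c≢d refl)
unaryCode-apart {suc s} {zero}  {zero}  c≢d = ⊥-elim (c≢d refl)
unaryCode-apart {suc s} {zero}  {suc d} c≢d = cong suc (wordDist-starsˡ (unaryCode d))
unaryCode-apart {suc s} {suc c} {zero}  c≢d = cong suc (wordDist-starsʳ (unaryCode c))
unaryCode-apart {suc s} {suc c} {suc d} c≢d = unaryCode-apart (c≢d ∘ cong suc)

module Blowup {m a L : ℕ} (base : Fin m × Fin a → Vec Sym L)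
               (base-kDist : ∀ v w → wordDist (base v) (base w) ≡ kDist v w) (s : ℕ) where

  copyCode : Fin m × Fin (suc s) → Fin a → Vec Sym (suc s * L + s)
  copyCode (p , c) t = inBlock c (base (p , t)) ++ unaryCode c

  copyCode-kDist : ∀ x y t u → wordDist (copyCode x t) (copyCode y u) ≡ kDist (uncurry combine x , t) (uncurry combine y , u)
  copyCode-kDist (p , c) (q , d) t u with c ≟ d
  ... | yes refl = begin
    wordDist (copyCode (p , c) t) (copyCode (q , c) u)
      ≡⟨ wordDist-++ (inBlock c (base (p , t))) _ (unaryCode c) _ ⟩
    wordDist (inBlock c (base (p , t))) (inBlock c (base (q , u))) + wordDist (unaryCode c) (unaryCode c)
      ≡⟨ cong₂ _+_ (inBlock-same c _ _) (wordDist-self (unaryCode c)) ⟩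
    wordDist (base (p , t)) (base (q , u)) + 0
      ≡⟨ trans (ℕ.+-identityʳ _) (base-kDist (p , t) (q , u)) ⟩
    kDist (p , t) (q , u)
      ≡⟨ kDist-relabel (λ {p} {q} → combine-injectiveˡ p c q c) p q t u ⟨
    kDist (combine p c , t) (combine q c , u) ∎
    where open ≡-Reasoning
  ... | no c≢d = begin
    wordDist (copyCode (p , c) t) (copyCode (q , d) u)
      ≡⟨ wordDist-++ (inBlock c (base (p , t))) _ (unaryCode c) _ ⟩
    wordDist (inBlock c (base (p , t))) (inBlock d (base (q , u))) + wordDist (unaryCode c) (unaryCode d)
      ≡⟨ cong₂ _+_ (inBlock-apart _ _ c≢d) (unaryCode-apart c≢d) ⟩
    1
      ≡⟨ kDist-across t u (c≢d ∘ combine-injectiveʳ p c q d) ⟨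
    kDist (combine p c , t) (combine q d , u) ∎
    where open ≡-Reasoning

  blowup : Fin (m * suc s) × Fin a → Vec Sym (suc s * L + s)
  blowup (i , t) = copyCode (remQuot (suc s) i) t

  blowup-kDist : ∀ v w → wordDist (blowup v) (blowup w) ≡ kDist v w
  blowup-kDist (i , t) (j , u) =
    trans (copyCode-kDist (remQuot (suc s) i) (remQuot (suc s) j) t u)
          (cong₂ (λ i j → kDist (i , t) (j , u)) (combine-remQuot {m} (suc s) i) (combine-remQuot {m} (suc s) j))

N₂≤-K-blowup : ∀ {a m L s} → 2 ≤ m → N₂≤ (K a m) L → 1 ≤ s → N₂≤ (K a (m * s)) (suc L * s ∸ 1)
N₂≤-K-blowup {a} {m} {L} {suc s} 2≤m (N , N≤L , base , base-addr) _ =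
  suc s * N + s , length≤ , blowup , kDist⇒isAddressing (≤-trans 2≤m (m≤m*n m (suc s))) blowup blowup-kDist
  where
  open Blowup base (isAddressing⇒kDist 2≤m base base-addr) s
  -- the bound suc L * suc s ∸ 1 reduces to s + L * suc s
  length≤ : suc s * N + s ≤ s + L * suc s
  length≤ = ≤-trans (≤-reflexive (trans (ℕ.+-comm _ s) (cong (s +_) (ℕ.*-comm (suc s) N))))
                    (ℕ.+-monoʳ-≤ s (ℕ.*-monoˡ-≤ (suc s) N≤L))

tableAddressing : ∀ {m a L} → Vec (Vec (Vec Sym L) a) m → Fin m × Fin a → Vec Sym L
tableAddressing table (p , t) = lookup (lookup table p) t

N₂≤-table : ∀ {m a L} (table : Vec (Vec (Vec Sym L) a) m) → 2 ≤ m →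
            {True (all? λ p → all? λ t → all? λ q → all? λ u →
                     wordDist (tableAddressing table (p , t)) (tableAddressing table (q , u)) ℕ.≟ kDist (p , t) (q , u))} →
            N₂≤ (K a m) L
N₂≤-table {L = L} table 2≤m {valid} =
  L , ℕ.≤-refl , tableAddressing table ,
  kDist⇒isAddressing 2≤m (tableAddressing table) (λ (p , t) (q , u) → toWitness valid p t q u)

table₃ : Vec (Vec (Vec Sym 7) 3) 3
table₃ =
    ( (s1 ∷ s1 ∷ s1 ∷ s1 ∷ s1 ∷ s1 ∷ star ∷ [])
      ∷ (s1 ∷ s0 ∷ s0 ∷ star ∷ s1 ∷ star ∷ star ∷ [])
      ∷ (s0 ∷ star ∷ star ∷ star ∷ s0 ∷ star ∷ s1 ∷ []) ∷ [])
  ∷ ( (s0 ∷ star ∷ star ∷ s1 ∷ s1 ∷ s1 ∷ star ∷ [])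
      ∷ (s1 ∷ star ∷ s1 ∷ s0 ∷ star ∷ s1 ∷ s1 ∷ [])
      ∷ (s1 ∷ s1 ∷ star ∷ s1 ∷ star ∷ s0 ∷ star ∷ []) ∷ [])
  ∷ ( (s1 ∷ s0 ∷ s1 ∷ s1 ∷ star ∷ star ∷ s1 ∷ [])
      ∷ (s1 ∷ s1 ∷ s0 ∷ star ∷ star ∷ s1 ∷ s1 ∷ [])
      ∷ (star ∷ star ∷ s1 ∷ s0 ∷ star ∷ star ∷ s0 ∷ []) ∷ [])
  ∷ []

table₄ : Vec (Vec (Vec Sym 13) 4) 4
table₄ =
    ( (s1 ∷ s1 ∷ star ∷ s1 ∷ s1 ∷ s1 ∷ s1 ∷ star ∷ star ∷ s1 ∷ star ∷ star ∷ star ∷ [])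
      ∷ (star ∷ s0 ∷ s0 ∷ s0 ∷ star ∷ s1 ∷ s1 ∷ star ∷ star ∷ s1 ∷ s1 ∷ star ∷ star ∷ [])
      ∷ (s0 ∷ star ∷ star ∷ s1 ∷ star ∷ s0 ∷ star ∷ star ∷ s1 ∷ s1 ∷ star ∷ s1 ∷ star ∷ [])
      ∷ (star ∷ star ∷ star ∷ star ∷ star ∷ s1 ∷ s0 ∷ s1 ∷ star ∷ s0 ∷ star ∷ s1 ∷ s1 ∷ []) ∷ [])
  ∷ ( (s0 ∷ star ∷ s1 ∷ star ∷ star ∷ s1 ∷ s1 ∷ star ∷ star ∷ star ∷ s1 ∷ s1 ∷ s1 ∷ [])
      ∷ (s1 ∷ star ∷ s0 ∷ s1 ∷ s0 ∷ star ∷ s1 ∷ star ∷ star ∷ star ∷ s1 ∷ s1 ∷ s1 ∷ [])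
      ∷ (s1 ∷ star ∷ star ∷ star ∷ s1 ∷ star ∷ s0 ∷ s1 ∷ s1 ∷ s1 ∷ s1 ∷ star ∷ star ∷ [])
      ∷ (star ∷ star ∷ s0 ∷ s0 ∷ star ∷ star ∷ s1 ∷ star ∷ star ∷ star ∷ s0 ∷ star ∷ star ∷ []) ∷ [])
  ∷ ( (s1 ∷ s0 ∷ star ∷ s1 ∷ s1 ∷ star ∷ s1 ∷ s1 ∷ s1 ∷ star ∷ star ∷ s1 ∷ s1 ∷ [])
      ∷ (star ∷ s1 ∷ s0 ∷ s0 ∷ star ∷ star ∷ s1 ∷ s1 ∷ s1 ∷ star ∷ s1 ∷ s1 ∷ s1 ∷ [])
      ∷ (star ∷ star ∷ star ∷ star ∷ star ∷ s1 ∷ s0 ∷ s0 ∷ star ∷ star ∷ star ∷ s1 ∷ s1 ∷ [])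
      ∷ (star ∷ star ∷ star ∷ s1 ∷ s0 ∷ star ∷ star ∷ s1 ∷ star ∷ star ∷ star ∷ s0 ∷ star ∷ []) ∷ [])
  ∷ ( (s0 ∷ star ∷ s0 ∷ s1 ∷ star ∷ s1 ∷ star ∷ s1 ∷ s1 ∷ s1 ∷ star ∷ s1 ∷ s1 ∷ [])
      ∷ (s1 ∷ star ∷ s1 ∷ star ∷ s0 ∷ star ∷ star ∷ s1 ∷ s1 ∷ s1 ∷ star ∷ s1 ∷ s1 ∷ [])
      ∷ (star ∷ star ∷ star ∷ star ∷ s1 ∷ s0 ∷ star ∷ star ∷ s0 ∷ star ∷ s1 ∷ star ∷ s1 ∷ [])
      ∷ (star ∷ star ∷ star ∷ star ∷ star ∷ star ∷ star ∷ star ∷ s1 ∷ s0 ∷ s1 ∷ s1 ∷ s0 ∷ []) ∷ [])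
  ∷ []

table₅ : Vec (Vec (Vec Sym 22) 5) 5
table₅ =
    ( (s1 ∷ s1 ∷ s1 ∷ star ∷ s1 ∷ star ∷ star ∷ s1 ∷ s1 ∷ star ∷ star ∷ s1 ∷ s1 ∷ star ∷ star ∷ star ∷ star ∷ s1 ∷ star ∷ s1 ∷ star ∷ star ∷ [])
      ∷ (s0 ∷ star ∷ star ∷ s0 ∷ s0 ∷ s1 ∷ star ∷ star ∷ s1 ∷ star ∷ s1 ∷ star ∷ s1 ∷ star ∷ s1 ∷ star ∷ star ∷ s1 ∷ star ∷ s1 ∷ s1 ∷ s1 ∷ [])
      ∷ (star ∷ s1 ∷ star ∷ s0 ∷ s1 ∷ star ∷ star ∷ s0 ∷ s0 ∷ star ∷ star ∷ star ∷ s1 ∷ star ∷ s1 ∷ s1 ∷ star ∷ s1 ∷ star ∷ s1 ∷ s1 ∷ star ∷ [])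
      ∷ (s1 ∷ s0 ∷ star ∷ star ∷ star ∷ s1 ∷ s1 ∷ star ∷ star ∷ star ∷ star ∷ s1 ∷ s0 ∷ s1 ∷ s1 ∷ star ∷ star ∷ s1 ∷ s1 ∷ star ∷ star ∷ s1 ∷ [])
      ∷ (s1 ∷ s0 ∷ star ∷ star ∷ star ∷ s1 ∷ star ∷ star ∷ star ∷ s1 ∷ star ∷ s1 ∷ s1 ∷ star ∷ s1 ∷ star ∷ star ∷ s0 ∷ s1 ∷ star ∷ star ∷ star ∷ []) ∷ [])
  ∷ ( (s0 ∷ star ∷ s1 ∷ star ∷ s1 ∷ star ∷ star ∷ s1 ∷ star ∷ s1 ∷ s1 ∷ star ∷ star ∷ s1 ∷ star ∷ star ∷ star ∷ star ∷ s1 ∷ star ∷ star ∷ star ∷ [])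
      ∷ (s1 ∷ s1 ∷ star ∷ s0 ∷ s0 ∷ s1 ∷ star ∷ star ∷ star ∷ s1 ∷ star ∷ s1 ∷ star ∷ s1 ∷ s1 ∷ star ∷ star ∷ star ∷ s1 ∷ star ∷ s1 ∷ s1 ∷ [])
      ∷ (star ∷ star ∷ s0 ∷ star ∷ s1 ∷ s1 ∷ star ∷ star ∷ s1 ∷ s0 ∷ star ∷ star ∷ s1 ∷ s1 ∷ s1 ∷ star ∷ star ∷ star ∷ s1 ∷ star ∷ s1 ∷ star ∷ [])
      ∷ (star ∷ star ∷ star ∷ star ∷ s1 ∷ star ∷ star ∷ s0 ∷ s1 ∷ s1 ∷ star ∷ star ∷ star ∷ s0 ∷ star ∷ s1 ∷ star ∷ s1 ∷ s1 ∷ star ∷ s1 ∷ star ∷ [])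
      ∷ (s1 ∷ s0 ∷ star ∷ star ∷ star ∷ star ∷ star ∷ star ∷ star ∷ s1 ∷ star ∷ star ∷ star ∷ s1 ∷ star ∷ s1 ∷ s1 ∷ star ∷ s0 ∷ s1 ∷ s1 ∷ s1 ∷ []) ∷ [])
  ∷ ( (s1 ∷ s0 ∷ s1 ∷ star ∷ star ∷ s1 ∷ s1 ∷ star ∷ star ∷ star ∷ s1 ∷ star ∷ s1 ∷ s1 ∷ s1 ∷ star ∷ s1 ∷ s1 ∷ s1 ∷ s1 ∷ star ∷ s1 ∷ [])
      ∷ (star ∷ star ∷ s0 ∷ star ∷ star ∷ s0 ∷ star ∷ star ∷ s1 ∷ star ∷ s1 ∷ star ∷ star ∷ s1 ∷ s1 ∷ star ∷ star ∷ star ∷ s1 ∷ star ∷ s1 ∷ s1 ∷ [])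
      ∷ (star ∷ s0 ∷ star ∷ star ∷ star ∷ s1 ∷ s0 ∷ star ∷ star ∷ s1 ∷ s0 ∷ s1 ∷ star ∷ s1 ∷ s1 ∷ star ∷ star ∷ s1 ∷ s1 ∷ s1 ∷ star ∷ s1 ∷ [])
      ∷ (star ∷ star ∷ s0 ∷ star ∷ star ∷ s1 ∷ star ∷ star ∷ star ∷ star ∷ s1 ∷ star ∷ star ∷ s1 ∷ s0 ∷ star ∷ star ∷ star ∷ s1 ∷ star ∷ s1 ∷ s1 ∷ [])
      ∷ (star ∷ star ∷ star ∷ star ∷ star ∷ s1 ∷ star ∷ star ∷ star ∷ star ∷ star ∷ star ∷ star ∷ star ∷ s1 ∷ s1 ∷ s1 ∷ star ∷ s0 ∷ s0 ∷ star ∷ s1 ∷ []) ∷ [])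
  ∷ ( (star ∷ star ∷ s0 ∷ s1 ∷ star ∷ s1 ∷ star ∷ star ∷ star ∷ s1 ∷ s1 ∷ star ∷ s1 ∷ s1 ∷ s1 ∷ s1 ∷ star ∷ s1 ∷ s1 ∷ star ∷ s1 ∷ s1 ∷ [])
      ∷ (s1 ∷ s0 ∷ s1 ∷ s0 ∷ star ∷ star ∷ s0 ∷ star ∷ star ∷ star ∷ s1 ∷ star ∷ star ∷ s1 ∷ star ∷ s1 ∷ s1 ∷ s1 ∷ s1 ∷ star ∷ s1 ∷ s1 ∷ [])
      ∷ (star ∷ s0 ∷ star ∷ s0 ∷ star ∷ star ∷ s1 ∷ star ∷ star ∷ s1 ∷ s0 ∷ s1 ∷ s1 ∷ s1 ∷ star ∷ s1 ∷ star ∷ s1 ∷ s1 ∷ star ∷ s1 ∷ s1 ∷ [])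
      ∷ (star ∷ star ∷ s0 ∷ s0 ∷ s1 ∷ s1 ∷ star ∷ star ∷ star ∷ s1 ∷ s1 ∷ star ∷ s1 ∷ star ∷ s1 ∷ s0 ∷ star ∷ s1 ∷ star ∷ star ∷ s1 ∷ star ∷ [])
      ∷ (star ∷ star ∷ s0 ∷ s0 ∷ star ∷ star ∷ star ∷ star ∷ star ∷ star ∷ s1 ∷ star ∷ s1 ∷ star ∷ star ∷ s1 ∷ star ∷ s1 ∷ star ∷ s1 ∷ s0 ∷ s1 ∷ []) ∷ [])
  ∷ ( (star ∷ star ∷ s0 ∷ s0 ∷ s1 ∷ s1 ∷ star ∷ s1 ∷ star ∷ s1 ∷ s1 ∷ s1 ∷ s1 ∷ star ∷ s1 ∷ s1 ∷ s1 ∷ s1 ∷ s1 ∷ star ∷ s1 ∷ s1 ∷ [])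
      ∷ (star ∷ s1 ∷ s1 ∷ star ∷ s1 ∷ star ∷ star ∷ s0 ∷ s1 ∷ star ∷ star ∷ s1 ∷ star ∷ s1 ∷ star ∷ star ∷ s1 ∷ star ∷ star ∷ s1 ∷ star ∷ s1 ∷ [])
      ∷ (star ∷ star ∷ star ∷ star ∷ star ∷ star ∷ star ∷ s1 ∷ star ∷ s1 ∷ s0 ∷ s0 ∷ star ∷ star ∷ star ∷ star ∷ s1 ∷ star ∷ s1 ∷ star ∷ star ∷ s1 ∷ [])
      ∷ (s1 ∷ s0 ∷ s1 ∷ star ∷ star ∷ star ∷ star ∷ star ∷ star ∷ star ∷ s1 ∷ star ∷ s1 ∷ s1 ∷ star ∷ star ∷ s0 ∷ s1 ∷ star ∷ star ∷ star ∷ s1 ∷ [])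
      ∷ (star ∷ star ∷ star ∷ star ∷ s0 ∷ star ∷ star ∷ star ∷ star ∷ star ∷ star ∷ s1 ∷ star ∷ star ∷ star ∷ star ∷ s1 ∷ s1 ∷ star ∷ star ∷ star ∷ s0 ∷ []) ∷ [])
  ∷ []

N₂≤-K₃₃ : N₂≤ (K 3 3) 7
N₂≤-K₃₃ = N₂≤-table table₃ (s≤s (s≤s z≤n))

N₂≤-K₄₄ : N₂≤ (K 4 4) 13
N₂≤-K₄₄ = N₂≤-table table₄ (s≤s (s≤s z≤n))

N₂≤-K₅₅ : N₂≤ (K 5 5) 22
N₂≤-K₅₅ = N₂≤-table table₅ (s≤s (s≤s z≤n))

N₂-K-bounds : ∀ {a L c s} → 1 ≤ a → N₂≤ (K (suc a) (suc a)) L → suc L ≤ c → 1 ≤ s →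
              N₂≥ (K (suc a) (suc a * s)) (suc a * a * s) × N₂≤ (K (suc a) (suc a * s)) (c * s ∸ 1)
N₂-K-bounds {a} {s = s} 1≤a K-addr L+1≤c 1≤s =
  N₂≥-mono (≤-reflexive reorder) (N₂≥-K (≤-trans 2≤a+1 (m≤m*n (suc a) s {{ℕ.>-nonZero 1≤s}}))) ,
  N₂≤-mono (ℕ.∸-monoˡ-≤ 1 (ℕ.*-monoˡ-≤ s L+1≤c)) (N₂≤-K-blowup 2≤a+1 K-addr 1≤s)
  where
  2≤a+1 : 2 ≤ suc a
  2≤a+1 = s≤s 1≤a
  reorder : suc a * a * s ≡ suc a * s * a
  reorder = trans (ℕ.*-assoc (suc a) a s) (trans (cong (suc a *_) (ℕ.*-comm a s)) (sym (ℕ.*-assoc (suc a) s a)))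

mainTheorem16 : (s : ℕ) → 1 ≤ s →
    (N₂≥ (K 3 (3 * s)) (6 * s) × N₂≤ (K 3 (3 * s)) (8 * s ∸ 1))
    × (N₂≥ (K 4 (4 * s)) (12 * s) × N₂≤ (K 4 (4 * s)) (15 * s ∸ 1))
    × (N₂≥ (K 5 (5 * s)) (20 * s) × N₂≤ (K 5 (5 * s)) (24 * s ∸ 1))
mainTheorem16 s 1≤s =
    N₂-K-bounds (s≤s z≤n) N₂≤-K₃₃ ℕ.≤-refl 1≤s
  , N₂-K-bounds (s≤s z≤n) N₂≤-K₄₄ (ℕ.n≤1+n 14) 1≤s
  , N₂-K-bounds (s≤s z≤n) N₂≤-K₅₅ (ℕ.n≤1+n 23) 1≤s
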